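{- Let $n, k, \ell$ be positive integers with $n \geq k\ell$ and $\ell \geq 2$, and let $\mathcal{P}$ be an intersecting family of $(k,\ell)$-subpartitions of $[n]$. Assume that there is no $k$-set that occurs as a class in every $(k,\ell)$-subpartition in $\mathcal{P}$. Then $$|\mathcal{P}| \leq \ell^2\, U(n-2k,\ell-2,k).$$
   Context: Let $[n]=\{1,\dots,n\}$. A $(k,\ell)$-subpartition of $[n]$ is a set $P=\{P_1,\dots,P_\ell\}$ of $\ell$ pairwise disjoint $k$-subsets of $[n]$ (called classes). Two $(k,\ell)$-subpartitions are intersecting if they have a common class; a family is intersecting if every two of its members are intersecting. For integers $m$, $j\ge 0$, $k$, define $U(m,j,k) = \frac{1}{j!}\prod_{i=0}^{j-1}\binom{m-ik}{k}$ (the number of $(k,j)$-subpartitions of an $m$-set; an empty product equals $1$, so $U(m,0,k)=1$). -}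

module Defs where

open import Data.Nat using (ℕ; zero; suc; _+_; _*_; _∸_; _/_; _!)
open import Data.Nat.Properties using (_!≢0)
open import Data.Nat.Combinatorics using (_C_)
open import Data.Fin.Subset using (Subset; ∣_∣; _∩_; ⊥)
open import Data.List using (List; length)
open import Data.List.Membership.Propositional using (_∈_)
open import Data.List.Relation.Unary.All using (All)
open import Data.List.Relation.Unary.AllPairs using (AllPairs)
open import Data.Product using (Σ; _×_)
open import Relation.Binary.PropositionalEquality using (_≡_)
open import Relation.Nullary using (¬_)
open import Function.Bundles using (_⇔_)

prodBinom : ℕ → ℕ → ℕ → ℕ
prodBinom m zero    k = 1
prodBinom m (suc j) k = prodBinom m j k * ((m ∸ j * k) C k)

-- U(m,j,k) = (1/j!) ∏_{i<j} C(m-ik,k)   (exact division)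
U : ℕ → ℕ → ℕ → ℕ
U m j k = _/_ (prodBinom m j k) (j !) {{j !≢0}}

Disjoint : ∀ {n} → Subset n → Subset n → Set
Disjoint A B = A ∩ B ≡ ⊥

-- a (k,ℓ)-subpartition of [n]: ℓ distinct, pairwise disjoint k-subsets.
-- Represented by a duplicate-free list of its classes; order is irrelevant
-- (see SameSubpartition below).
record Subpartition (n k ℓ : ℕ) : Set where
  constructor mkSP
  field
    classes  : List (Subset n)
    size     : length classes ≡ ℓ
    allK     : All (λ A → ∣ A ∣ ≡ k) classes
    disjoint : AllPairs Disjoint classes
open Subpartition public

_isClassOf_ : ∀ {n k ℓ} → Subset n → Subpartition n k ℓ → Set
A isClassOf P = A ∈ classes P

SameSubpartition : ∀ {n k ℓ} → Subpartition n k ℓ → Subpartition n k ℓ → Set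
SameSubpartition P Q = ∀ A → (A isClassOf P) ⇔ (A isClassOf Q)

record Family (n k ℓ : ℕ) : Set where
  constructor mkFam
  field
    members  : List (Subpartition n k ℓ)
    distinct : AllPairs (λ P Q → ¬ SameSubpartition P Q) members
open Family public

card : ∀ {n k ℓ} → Family n k ℓ → ℕ
card F = length (members F)

Intersect : ∀ {n k ℓ} → Subpartition n k ℓ → Subpartition n k ℓ → Set
Intersect P Q = Σ _ λ A → (A isClassOf P) × (A isClassOf Q)

IsIntersecting : ∀ {n k ℓ} → Family n k ℓ → Set
IsIntersecting F = ∀ P Q → P ∈ members F → Q ∈ members F → Intersect P Q

HasCommonClass : ∀ {n k ℓ} → Family n k ℓ → Set
HasCommonClass {n} {k} F =
  Σ (Subset n) λ A → (∣ A ∣ ≡ k) × All (λ P → A isClassOf P) (members F)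

-- Fix a member P of the family. For every class A of P some member Q_A avoids A, since A is
-- not common to all members. Any member R meets P in a class A and Q_A in a class C ≠ A, so R
-- contains one of the at most ℓ² pairs {A, C} with A ∈ P and C ∈ Q_A. Deleting two fixed
-- classes maps the members containing both injectively to (k, ℓ-2)-subpartitions of an
-- (n-2k)-set. Finally, j! times the number of (k, j)-subpartitions of an m-set is at most
-- ∏_{i<j} C(m-ik, k): double count the pairs (A, R) with A a class of R, where every R has j
-- classes and each k-set A is a class of at most as many R as there are (k, j-1)-subpartitions
-- of the complement of A.
module Submission where

open import Defs
open import Data.Nat using (ℕ; zero; suc; _+_; _*_; _∸_; _≤_; _≥_; _^_; z≤n; s≤s; _!; NonZero)
open import Data.Nat.Properties
open import Algebra.Properties.CommutativeSemigroup *-commutativeSemigroup using (x∙yz≈y∙xz)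
open import Data.Nat.Combinatorics using (_C_; nCk+nC[k+1]≡[n+1]C[k+1])
open import Data.Nat.DivMod using (_/_; m*n/n≡m; /-monoˡ-≤)
open import Data.Nat.ListAction using (sum)
open import Data.Bool.Properties using () renaming (_≟_ to _≟ᵇ_)
open import Data.Vec as Vec using ([]; _∷_)
open import Data.Vec.Properties using (≡-dec)
open import Data.Fin.Subset using (Subset; inside; outside; ∣_∣; _∩_; _─_; ⊥; ⊤; _⊆_) renaming (_∈_ to _∈ₛ_)
open import Data.Fin.Subset.Properties
  using (drop-∷-⊆; out⊆; in⊆in; ⊆⊤; p⊆q⇒∣p∣≤∣q∣; ∣⊤∣≡n; ∣⊥∣≡0; ∩-comm; ∩-idem; ∉⊥; x∈p∩q⁺;
         x∈p∧x∉q⇒x∈p─q)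
open import Data.List using (List; []; _∷_; length; map; _++_; filter; concatMap)
open import Data.List.Properties using (length-map; length-++; filter-all)
open import Data.List.Membership.Propositional using (_∈_; _∉_)
open import Data.List.Membership.Propositional.Properties
  using (∈-map⁺; ∈-map⁻; ∈-++⁺ˡ; ∈-++⁺ʳ; ∈-++⁻; ∈-filter⁺; ∈-filter⁻; ∈-concatMap⁺)
import Data.List.Membership.DecPropositional as DecMembership
open import Data.List.Relation.Unary.All as All using (All; []; _∷_)
import Data.List.Relation.Unary.All.Properties as All
open import Data.List.Relation.Unary.AllPairs as AllPairs using (AllPairs; []; _∷_)
import Data.List.Relation.Unary.AllPairs.Properties as AllPairs
open import Data.List.Relation.Unary.Any as Any using (here; there)
open import Data.List.Relation.Unary.Unique.Propositional using (Unique)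
open import Data.Product using (Σ; _×_; _,_; proj₁; proj₂)
open import Data.Sum using (inj₁; inj₂)
open import Data.Empty using (⊥-elim)
open import Function using (_∘_; id)
open import Function.Bundles using (_⇔_; mk⇔; Equivalence)
open import Relation.Binary.Definitions using (DecidableEquality; Symmetric)
open import Relation.Binary.PropositionalEquality
open import Relation.Nullary using (¬_; Dec; yes; no)
open import Relation.Nullary.Decidable using (¬?; _×-dec_)

m*n≤o⇒n≤o/m : ∀ m {n o} .{{_ : NonZero m}} → m * n ≤ o → n ≤ o / m
m*n≤o⇒n≤o/m m {n} {o} m*n≤o = begin
  n         ≡⟨ m*n/n≡m n m ⟨
  n * m / m ≤⟨ /-monoˡ-≤ m (≤-trans (≤-reflexive (*-comm n m)) m*n≤o) ⟩
  o / m     ∎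
  where open ≤-Reasoning

prodBinom-suc : ∀ m j k → prodBinom m (suc j) k ≡ (m C k) * prodBinom (m ∸ k) j k
prodBinom-suc m zero    k = trans (*-identityˡ (m C k)) (sym (*-identityʳ (m C k)))
prodBinom-suc m (suc j) k = begin
  prodBinom m (suc j) k * ((m ∸ (k + j * k)) C k)
    ≡⟨ cong₂ _*_ (prodBinom-suc m j k) (cong (_C k) (sym (∸-+-assoc m k (j * k)))) ⟩
  (m C k) * prodBinom (m ∸ k) j k * ((m ∸ k ∸ j * k) C k)
    ≡⟨ *-assoc (m C k) _ _ ⟩
  (m C k) * (prodBinom (m ∸ k) j k * ((m ∸ k ∸ j * k) C k)) ∎
  where open ≡-Reasoning

module _ {a} {A : Set a} where

  sum-map-≤ : ∀ {f : A → ℕ} {b} xs → (∀ {x} → x ∈ xs → f x ≤ b) → sum (map f xs) ≤ length xs * b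
  sum-map-≤ []       _     = z≤n
  sum-map-≤ (x ∷ xs) f≤b = +-mono-≤ (f≤b (here refl)) (sum-map-≤ xs (f≤b ∘ there))

  *-sum-map : ∀ c (f : A → ℕ) xs → c * sum (map f xs) ≡ sum (map ((c *_) ∘ f) xs)
  *-sum-map c f []       = *-zeroʳ c
  *-sum-map c f (x ∷ xs) = trans (*-distribˡ-+ c (f x) _) (cong (c * f x +_) (*-sum-map c f xs))

  length-concatMap : ∀ {b} {B : Set b} (f : A → List B) xs → length (concatMap f xs) ≡ sum (map (length ∘ f) xs)
  length-concatMap f []       = refl
  length-concatMap f (x ∷ xs) = trans (length-++ (f x)) (cong (length (f x) +_) (length-concatMap f xs))

  AllPairs-lookup : ∀ {r} {R : A → A → Set r} → Symmetric R → ∀ {xs x y} →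
                    AllPairs R xs → x ∈ xs → y ∈ xs → x ≢ y → R x y
  AllPairs-lookup sym (px ∷ pxs) (here refl) (here refl) x≢y = ⊥-elim (x≢y refl)
  AllPairs-lookup sym (px ∷ pxs) (here refl) (there y∈)  _   = All.lookup px y∈
  AllPairs-lookup sym (px ∷ pxs) (there x∈)  (here refl) _   = sym (All.lookup px x∈)
  AllPairs-lookup sym (px ∷ pxs) (there x∈)  (there y∈)  x≢y = AllPairs-lookup sym pxs x∈ y∈ x≢y

  ∈⇒deletion : ∀ {x ys} → x ∈ ys →
               Σ (List A) λ zs → suc (length zs) ≡ length ys × (∀ {y} → y ∈ ys → y ≢ x → y ∈ zs)
  ∈⇒deletion {ys = _ ∷ ys} (here refl) =
    ys , refl , λ { (here refl) y≢x → ⊥-elim (y≢x refl) ; (there y∈) _ → y∈ }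
  ∈⇒deletion {ys = y ∷ ys} (there x∈) with ∈⇒deletion x∈
  ... | zs , len , ⊆zs =
    y ∷ zs , cong suc len , λ { (here refl) _ → here refl ; (there y∈) y≢x → there (⊆zs y∈ y≢x) }

  Unique∧⊆⇒length≤ : ∀ {xs ys : List A} → Unique xs → (∀ {x} → x ∈ xs → x ∈ ys) → length xs ≤ length ys
  Unique∧⊆⇒length≤ {[]}     _           _     = z≤n
  Unique∧⊆⇒length≤ {x ∷ xs} (x∉xs ∷ u) xs⊆ys with ∈⇒deletion (xs⊆ys (here refl))
  ... | zs , len , ys-x⊆zs =
    ≤-trans (s≤s (Unique∧⊆⇒length≤ u λ y∈xs →
                    ys-x⊆zs (xs⊆ys (there y∈xs)) (λ { refl → All.lookup x∉xs y∈xs refl })))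
            (≤-reflexive len)

module DoubleCounting {a b r} {K : Set a} {E : Set b} {R : K → E → Set r} (R? : ∀ p x → Dec (R p x)) where

  incidences : List K → List E → ℕ
  incidences ps xs = sum (map (λ p → length (filter (R? p) xs)) ps)

  degree : E → List K → ℕ
  degree x ps = length (filter (λ p → R? p x) ps)

  incidences-∷ : ∀ ps x xs → incidences ps (x ∷ xs) ≡ incidences ps xs + degree x ps
  incidences-∷ []       x xs = refl
  incidences-∷ (p ∷ ps) x xs with R? p x
  ... | yes _ = trans (cong (suc ∘ (length (filter (R? p) xs) +_)) (incidences-∷ ps x xs))
                      (sym (trans (+-suc _ _) (cong suc (+-assoc (length (filter (R? p) xs)) _ _))))
  ... | no  _ = trans (cong (length (filter (R? p) xs) +_) (incidences-∷ ps x xs))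
                      (sym (+-assoc (length (filter (R? p) xs)) _ _))

  *-length≤incidences : ∀ j ps xs → All (λ x → j ≤ degree x ps) xs → j * length xs ≤ incidences ps xs
  *-length≤incidences j ps []       []       = subst (_≤ incidences ps []) (sym (*-zeroʳ j)) z≤n
  *-length≤incidences j ps (x ∷ xs) (j≤ ∷ js) = begin
    j * suc (length xs)              ≡⟨ *-suc j (length xs) ⟩
    j + j * length xs                ≤⟨ +-mono-≤ j≤ (*-length≤incidences j ps xs js) ⟩
    degree x ps + incidences ps xs   ≡⟨ +-comm (degree x ps) _ ⟩
    incidences ps xs + degree x ps   ≡⟨ incidences-∷ ps x xs ⟨
    incidences ps (x ∷ xs)           ∎
    where open ≤-Reasoning

  Unique⇒length≤degree : ∀ {x qs ps} → Unique qs → All (λ q → q ∈ ps × R q x) qs → length qs ≤ degree x ps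
  Unique⇒length≤degree u qs∈ = Unique∧⊆⇒length≤ u λ q∈ →
    let q∈ps , Rqx = All.lookup qs∈ q∈ in ∈-filter⁺ (λ p → R? p _) q∈ps Rqx

_≟ˢ_ : ∀ {n} → DecidableEquality (Subset n)
_≟ˢ_ = ≡-dec _≟ᵇ_

∣p─q∣≡∣p∣∸∣q∣ : ∀ {n} {p q : Subset n} → q ⊆ p → ∣ p ─ q ∣ ≡ ∣ p ∣ ∸ ∣ q ∣
∣p─q∣≡∣p∣∸∣q∣ {p = []}          {[]}          _   = refl
∣p─q∣≡∣p∣∸∣q∣ {p = s ∷ p}       {inside ∷ q}  q⊆p with q⊆p Vec.here
... | Vec.here = ∣p─q∣≡∣p∣∸∣q∣ (drop-∷-⊆ q⊆p)
∣p─q∣≡∣p∣∸∣q∣ {p = outside ∷ p} {outside ∷ q} q⊆p = ∣p─q∣≡∣p∣∸∣q∣ (drop-∷-⊆ q⊆p)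
∣p─q∣≡∣p∣∸∣q∣ {p = inside ∷ p}  {outside ∷ q} q⊆p =
  trans (cong suc (∣p─q∣≡∣p∣∸∣q∣ (drop-∷-⊆ q⊆p)))
        (sym (+-∸-assoc 1 (p⊆q⇒∣p∣≤∣q∣ (drop-∷-⊆ q⊆p))))

⊆─ : ∀ {n} {p q r : Subset n} → p ⊆ q → Disjoint p r → p ⊆ q ─ r
⊆─ p⊆q p∩r≡⊥ x∈p =
  x∈p∧x∉q⇒x∈p─q (p⊆q x∈p) λ x∈r → ∉⊥ (subst (_ ∈ₛ_) p∩r≡⊥ (x∈p∩q⁺ (x∈p , x∈r)))

Disjoint-sym : ∀ {n} → Symmetric (Disjoint {n})
Disjoint-sym {x = p} {q} p∩q≡⊥ = trans (∩-comm q p) p∩q≡⊥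

nonempty⇒¬Disjoint-self : ∀ {n} {p : Subset n} → 1 ≤ ∣ p ∣ → ¬ Disjoint p p
nonempty⇒¬Disjoint-self {n} {p} 1≤∣p∣ p∩p≡⊥ =
  <⇒≢ 1≤∣p∣ (sym (trans (cong ∣_∣ (trans (sym (∩-idem p)) p∩p≡⊥)) (∣⊥∣≡0 n)))

kSubsets : ∀ {n} → Subset n → ℕ → List (Subset n)
kSubsets []            zero    = [] ∷ []
kSubsets []            (suc k) = []
kSubsets (outside ∷ X) k       = map (outside ∷_) (kSubsets X k)
kSubsets (inside ∷ X)  zero    = map (outside ∷_) (kSubsets X zero)
kSubsets (inside ∷ X)  (suc k) = map (inside ∷_) (kSubsets X k) ++ map (outside ∷_) (kSubsets X (suc k))

length-kSubsets : ∀ {n} (X : Subset n) k → length (kSubsets X k) ≡ ∣ X ∣ C k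
length-kSubsets []            zero    = refl
length-kSubsets []            (suc k) = refl
length-kSubsets (outside ∷ X) k       = trans (length-map _ (kSubsets X k)) (length-kSubsets X k)
length-kSubsets (inside ∷ X)  zero    = trans (length-map _ (kSubsets X zero)) (length-kSubsets X zero)
length-kSubsets (inside ∷ X)  (suc k) = begin
  length (map (inside ∷_) (kSubsets X k) ++ map (outside ∷_) (kSubsets X (suc k)))
    ≡⟨ length-++ (map (inside ∷_) (kSubsets X k)) ⟩
  length (map (inside ∷_) (kSubsets X k)) + length (map (outside ∷_) (kSubsets X (suc k)))
    ≡⟨ cong₂ _+_ (trans (length-map _ (kSubsets X k)) (length-kSubsets X k))
                 (trans (length-map _ (kSubsets X (suc k))) (length-kSubsets X (suc k))) ⟩
  ∣ X ∣ C k + ∣ X ∣ C suc k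
    ≡⟨ nCk+nC[k+1]≡[n+1]C[k+1] ∣ X ∣ k ⟩
  suc ∣ X ∣ C suc k ∎
  where open ≡-Reasoning

⊆⇒∈kSubsets : ∀ {n} {A X : Subset n} → A ⊆ X → A ∈ kSubsets X ∣ A ∣
⊆⇒∈kSubsets {A = []}          {[]}          _   = here refl
⊆⇒∈kSubsets {A = inside ∷ A}  {s ∷ X}       A⊆X with A⊆X Vec.here
... | Vec.here = ∈-++⁺ˡ (∈-map⁺ _ (⊆⇒∈kSubsets (drop-∷-⊆ A⊆X)))
⊆⇒∈kSubsets {A = outside ∷ A} {outside ∷ X} A⊆X = ∈-map⁺ _ (⊆⇒∈kSubsets (drop-∷-⊆ A⊆X))
⊆⇒∈kSubsets {A = outside ∷ A} {inside ∷ X}  A⊆X with ∣ A ∣ | ⊆⇒∈kSubsets (drop-∷-⊆ A⊆X)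
... | zero  | A∈ = ∈-map⁺ _ A∈
... | suc m | A∈ = ∈-++⁺ʳ (map (inside ∷_) (kSubsets X m)) (∈-map⁺ _ A∈)

∈kSubsets⇒ : ∀ {n} (X : Subset n) k {A} → A ∈ kSubsets X k → A ⊆ X × ∣ A ∣ ≡ k
∈kSubsets⇒ []            zero    (here refl) = id , refl
∈kSubsets⇒ (outside ∷ X) k       A∈ with ∈-map⁻ _ A∈
... | _ , B∈ , refl = let B⊆X , ∣B∣≡k = ∈kSubsets⇒ X k B∈ in out⊆ B⊆X , ∣B∣≡k
∈kSubsets⇒ (inside ∷ X)  zero    A∈ with ∈-map⁻ _ A∈
... | _ , B∈ , refl = let B⊆X , ∣B∣≡k = ∈kSubsets⇒ X zero B∈ in out⊆ B⊆X , ∣B∣≡k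
∈kSubsets⇒ (inside ∷ X)  (suc k) A∈ with ∈-++⁻ (map (inside ∷_) (kSubsets X k)) A∈
... | inj₁ A∈ˡ with ∈-map⁻ _ A∈ˡ
...   | _ , B∈ , refl = let B⊆X , ∣B∣≡k = ∈kSubsets⇒ X k B∈ in in⊆in B⊆X , cong suc ∣B∣≡k
∈kSubsets⇒ (inside ∷ X)  (suc k) A∈ | inj₂ A∈ʳ with ∈-map⁻ _ A∈ʳ
...   | _ , B∈ , refl = let B⊆X , ∣B∣≡k = ∈kSubsets⇒ X (suc k) B∈ in out⊆ B⊆X , ∣B∣≡k

SameClasses : ∀ {n} → List (Subset n) → List (Subset n) → Set
SameClasses R R′ = ∀ A → (A ∈ R) ⇔ (A ∈ R′)

Distinct : ∀ {n} → List (List (Subset n)) → Set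
Distinct = AllPairs (λ R R′ → ¬ SameClasses R R′)

IsSubpartition : ∀ {n} → ℕ → ℕ → Subset n → List (Subset n) → Set
IsSubpartition k j X R = length R ≡ j × All (λ A → ∣ A ∣ ≡ k × A ⊆ X) R × AllPairs Disjoint R

module _ {n : ℕ} where

  open DecMembership (_≟ˢ_ {n}) using (_∈?_)

  delete : Subset n → List (Subset n) → List (Subset n)
  delete A = filter (λ B → ¬? (B ≟ˢ A))

  ∈-delete⁺ : ∀ {A B R} → B ∈ R → B ≢ A → B ∈ delete A R
  ∈-delete⁺ = ∈-filter⁺ (λ B → ¬? (B ≟ˢ _))

  ∈-delete⁻ : ∀ {A B R} → B ∈ delete A R → B ∈ R × B ≢ A
  ∈-delete⁻ = ∈-filter⁻ (λ B → ¬? (B ≟ˢ _))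

  length-delete : ∀ {A R} → Unique R → A ∈ R → suc (length (delete A R)) ≡ length R
  length-delete {A} {B ∷ R} (B∉R ∷ u) A∈ with B ≟ˢ A
  ... | yes refl = cong (suc ∘ length) (filter-all (λ C → ¬? (C ≟ˢ A)) (All.map (_∘ sym) B∉R))
  length-delete {A} {B ∷ R} (B∉R ∷ u) (here refl) | no B≢A = ⊥-elim (B≢A refl)
  length-delete {A} {B ∷ R} (B∉R ∷ u) (there A∈)  | no _   = cong suc (length-delete u A∈)

  delete-SameClasses⁻ : ∀ {A R R′} → A ∈ R → A ∈ R′ → SameClasses (delete A R) (delete A R′) → SameClasses R R′
  delete-SameClasses⁻ {A} A∈R A∈R′ same B with B ≟ˢ A
  ... | yes refl = mk⇔ (λ _ → A∈R′) (λ _ → A∈R)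
  ... | no B≢A   = mk⇔ (λ B∈R  → proj₁ (∈-delete⁻ (Equivalence.to   (same B) (∈-delete⁺ B∈R  B≢A))))
                       (λ B∈R′ → proj₁ (∈-delete⁻ (Equivalence.from (same B) (∈-delete⁺ B∈R′ B≢A))))

  delete-Distinct : ∀ {A L} → All (A ∈_) L → Distinct L → Distinct (map (delete A) L)
  delete-Distinct []          []         = []
  delete-Distinct (A∈R ∷ A∈L) (R≉ ∷ dist) =
    All.map⁺ (All.zipWith (λ (A∈R′ , R≉R′) → R≉R′ ∘ delete-SameClasses⁻ A∈R A∈R′) (A∈L , R≉))
      ∷ delete-Distinct A∈L dist

  classes-unique : ∀ {k} {R : List (Subset n)} → 1 ≤ k → All (λ A → ∣ A ∣ ≡ k) R → AllPairs Disjoint R → Unique R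
  classes-unique 1≤k []            []           = []
  classes-unique 1≤k (∣A∣≡k ∷ ∣R∣≡k) (A-disj ∷ disj) =
    All.map (λ A∩B≡⊥ → λ { refl → nonempty⇒¬Disjoint-self (≤-trans 1≤k (≤-reflexive (sym ∣A∣≡k))) A∩B≡⊥ })
            A-disj
      ∷ classes-unique 1≤k ∣R∣≡k disj

  ∣─class∣ : ∀ {k j} {X A : Subset n} {R} → IsSubpartition k j X R → A ∈ R → ∣ X ─ A ∣ ≡ ∣ X ∣ ∸ k
  ∣─class∣ (_ , classes , _) A∈R = let ∣A∣≡k , A⊆X = All.lookup classes A∈R in
    trans (∣p─q∣≡∣p∣∸∣q∣ A⊆X) (cong (_ ∸_) ∣A∣≡k)

  delete-IsSubpartition : ∀ {k j X R A} → 1 ≤ k → IsSubpartition k (suc j) X R → A ∈ R →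
                          IsSubpartition k j (X ─ A) (delete A R)
  delete-IsSubpartition {A = A} 1≤k (len , classes , disj) A∈R =
      suc-injective (trans (length-delete (classes-unique 1≤k (All.map proj₁ classes) disj) A∈R) len)
    , All.tabulate (λ B∈ → let B∈R , B≢A = ∈-delete⁻ B∈ ; ∣B∣≡k , B⊆X = All.lookup classes B∈R in
                             ∣B∣≡k , ⊆─ B⊆X (AllPairs-lookup Disjoint-sym disj B∈R A∈R B≢A))
    , AllPairs.filter⁺ (λ B → ¬? (B ≟ˢ A)) disj

  firstWithout : Subset n → List (List (Subset n)) → List (Subset n)
  firstWithout A []      = []
  firstWithout A (R ∷ L) with A ∈? R
  ... | yes _ = firstWithout A L
  ... | no  _ = R

  A∉firstWithout : ∀ A L → A ∉ firstWithout A L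
  A∉firstWithout A []      ()
  A∉firstWithout A (R ∷ L) with A ∈? R
  ... | yes _  = A∉firstWithout A L
  ... | no A∉R = A∉R

  length-firstWithout : ∀ {ℓ} A L → All (λ R → length R ≡ ℓ) L → length (firstWithout A L) ≤ ℓ
  length-firstWithout A []      _            = z≤n
  length-firstWithout A (R ∷ L) (len ∷ lens) with A ∈? R
  ... | yes _ = length-firstWithout A L lens
  ... | no  _ = ≤-reflexive len

  firstWithout∈ : ∀ A L → ¬ All (A ∈_) L → firstWithout A L ∈ L
  firstWithout∈ A []      ¬all = ⊥-elim (¬all [])
  firstWithout∈ A (R ∷ L) ¬all with A ∈? R
  ... | yes A∈R = there (firstWithout∈ A L (¬all ∘ (A∈R ∷_)))
  ... | no  _   = here refl

  module _ {k : ℕ} (1≤k : 1 ≤ k) where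

    delete-all : ∀ {j X A L} → All (IsSubpartition k (suc j) X) L → All (A ∈_) L →
                 All (IsSubpartition k j (X ─ A)) (map (delete A) L)
    delete-all subp A∈L = All.map⁺ (All.zipWith (λ (s , A∈) → delete-IsSubpartition 1≤k s A∈) (subp , A∈L))

    j!*length≤prodBinom : ∀ j X L → Distinct L → All (IsSubpartition k j X) L → j ! * length L ≤ prodBinom ∣ X ∣ j k
    j!*length≤prodBinom zero X []               _                 _ = z≤n
    j!*length≤prodBinom zero X (_ ∷ [])         _                 _ = ≤-refl
    j!*length≤prodBinom zero X ([] ∷ [] ∷ _)    ((R≉R′ ∷ _) ∷ _) _ = ⊥-elim (R≉R′ λ _ → mk⇔ id id)
    j!*length≤prodBinom zero X ((_ ∷ _) ∷ _)    _ ((() , _) ∷ _)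
    j!*length≤prodBinom zero X (_ ∷ (_ ∷ _) ∷ _) _ (_ ∷ (() , _) ∷ _)
    j!*length≤prodBinom (suc j) X L dist subp = begin
      suc j ! * length L                          ≡⟨ *-assoc (suc j) (j !) (length L) ⟩
      suc j * (j ! * length L)                    ≡⟨ x∙yz≈y∙xz (suc j) (j !) (length L) ⟩
      j ! * (suc j * length L)
        ≤⟨ *-monoʳ-≤ (j !) (*-length≤incidences (suc j) ks L (All.map degree≥ subp)) ⟩
      j ! * incidences ks L                       ≡⟨ *-sum-map (j !) _ ks ⟩
      sum (map (λ A → j ! * length (filter (A ∈?_) L)) ks)
                                                  ≤⟨ sum-map-≤ ks containing ⟩
      length ks * prodBinom (∣ X ∣ ∸ k) j k      ≡⟨ cong (_* prodBinom (∣ X ∣ ∸ k) j k) (length-kSubsets X k) ⟩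
      (∣ X ∣ C k) * prodBinom (∣ X ∣ ∸ k) j k    ≡⟨ prodBinom-suc ∣ X ∣ j k ⟨
      prodBinom ∣ X ∣ (suc j) k                   ∎
      where
      open ≤-Reasoning
      open DoubleCounting (λ A R → A ∈? R)
      ks = kSubsets X k

      degree≥ : ∀ {R} → IsSubpartition k (suc j) X R → suc j ≤ degree R ks
      degree≥ {R} (len , classes , disj) = subst (_≤ degree R ks) len
        (Unique⇒length≤degree (classes-unique 1≤k (All.map proj₁ classes) disj)
          (All.tabulate λ A∈R → let ∣A∣≡k , A⊆X = All.lookup classes A∈R in
            subst (λ m → _ ∈ kSubsets X m) ∣A∣≡k (⊆⇒∈kSubsets A⊆X) , A∈R))

      containing : ∀ {A} → A ∈ ks → j ! * length (filter (A ∈?_) L) ≤ prodBinom (∣ X ∣ ∸ k) j k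
      containing {A} A∈ks = let A⊆X , ∣A∣≡k = ∈kSubsets⇒ X k A∈ks ; L′ = filter (A ∈?_) L in
        subst₂ (λ l m → j ! * l ≤ prodBinom m j k)
          (length-map (delete A) L′)
          (trans (∣p─q∣≡∣p∣∸∣q∣ A⊆X) (cong (_ ∸_) ∣A∣≡k))
          (j!*length≤prodBinom j (X ─ A) (map (delete A) L′)
            (delete-Distinct (All.all-filter (A ∈?_) L) (AllPairs.filter⁺ (A ∈?_) dist))
            (delete-all (All.filter⁺ (A ∈?_) subp) (All.all-filter (A ∈?_) L)))

    length≤U : ∀ j X L → Distinct L → All (IsSubpartition k j X) L → length L ≤ U ∣ X ∣ j k
    length≤U j X L dist subp = m*n≤o⇒n≤o/m (j !) {{j !≢0}} (j!*length≤prodBinom j X L dist subp)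

    containing-pair≤U : ∀ j X {A C} L → A ≢ C → Distinct L → All (IsSubpartition k (2 + j) X) L →
                        All (λ R → A ∈ R × C ∈ R) L → length L ≤ U (∣ X ∣ ∸ 2 * k) j k
    containing-pair≤U j X         []          _   _    _                        _ = z≤n
    containing-pair≤U j X {A} {C} L@(R ∷ _) A≢C dist subp@(subpR ∷ _) AC∈L@((A∈R , C∈R) ∷ _) =
      subst₂ (λ l m → l ≤ U m j k) (trans (length-map (delete C) (map (delete A) L)) (length-map (delete A) L)) ∣X─A─C∣
        (length≤U j (X ─ A ─ C) (map (delete C) (map (delete A) L))
          (delete-Distinct C∈rest (delete-Distinct (All.map proj₁ AC∈L) dist))
          (delete-all (delete-all subp (All.map proj₁ AC∈L)) C∈rest))
      where
      C∈rest : All (C ∈_) (map (delete A) L)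
      C∈rest = All.map⁺ (All.map (λ (_ , C∈) → ∈-delete⁺ C∈ (A≢C ∘ sym)) AC∈L)

      ∣X─A─C∣ : ∣ X ─ A ─ C ∣ ≡ ∣ X ∣ ∸ 2 * k
      ∣X─A─C∣ = begin
        ∣ X ─ A ─ C ∣  ≡⟨ ∣─class∣ (delete-IsSubpartition 1≤k subpR A∈R) (∈-delete⁺ C∈R (A≢C ∘ sym)) ⟩
        ∣ X ─ A ∣ ∸ k  ≡⟨ cong (_∸ k) (∣─class∣ subpR A∈R) ⟩
        ∣ X ∣ ∸ k ∸ k  ≡⟨ ∸-+-assoc ∣ X ∣ k k ⟩
        ∣ X ∣ ∸ (k + k) ≡⟨ cong (λ m → ∣ X ∣ ∸ (k + m)) (+-identityʳ k) ⟨
        ∣ X ∣ ∸ 2 * k  ∎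
        where open ≡-Reasoning

    intersecting-bound : ∀ j X L → Distinct L → All (IsSubpartition k (2 + j) X) L →
      (∀ {R R′} → R ∈ L → R′ ∈ L → Σ (Subset n) λ A → A ∈ R × A ∈ R′) →
      ¬ (Σ (Subset n) λ A → ∣ A ∣ ≡ k × All (A ∈_) L) →
      length L ≤ (2 + j) ^ 2 * U (∣ X ∣ ∸ 2 * k) j k
    intersecting-bound j X []        _    _    _         _        = z≤n
    intersecting-bound j X L@(P ∷ _) dist subp intersect noCommon = begin
      length L              ≡⟨ *-identityˡ (length L) ⟨
      1 * length L          ≤⟨ *-length≤incidences 1 pairs L (All.tabulate covered) ⟩
      incidences pairs L    ≤⟨ sum-map-≤ pairs (λ AC∈ → containing-pair≤U j X _ (All.lookup pairs-distinct AC∈)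
                                  (AllPairs.filter⁺ (R? _) dist) (All.filter⁺ (R? _) subp) (All.all-filter (R? _) L)) ⟩
      length pairs * B      ≤⟨ *-monoˡ-≤ B length-pairs ⟩
      ℓ ^ 2 * B             ∎
      where
      open ≤-Reasoning
      ℓ = 2 + j
      B = U (∣ X ∣ ∸ 2 * k) j k

      R? : ∀ (AC : Subset n × Subset n) R → Dec (proj₁ AC ∈ R × proj₂ AC ∈ R)
      R? (A , C) R = A ∈? R ×-dec C ∈? R
      open DoubleCounting R?

      partner : Subset n → List (Subset n × Subset n)
      partner A = map (A ,_) (firstWithout A L)

      pairs : List (Subset n × Subset n)
      pairs = concatMap partner P

      pairs-distinct : All (λ (A , C) → A ≢ C) pairs
      pairs-distinct = All.concat⁺ (All.map⁺ (All.universal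
        (λ A → All.map⁺ (All.¬Any⇒All¬ (firstWithout A L) (A∉firstWithout A L))) P))

      length-pairs : length pairs ≤ ℓ ^ 2
      length-pairs = begin
        length pairs                      ≡⟨ length-concatMap partner P ⟩
        sum (map (length ∘ partner) P)    ≤⟨ sum-map-≤ P (λ {A} _ → ≤-trans (≤-reflexive (length-map _ (firstWithout A L)))
                                               (length-firstWithout A L (All.map proj₁ subp))) ⟩
        length P * ℓ                      ≡⟨ cong (_* ℓ) (proj₁ (All.lookup subp (here refl))) ⟩
        ℓ * ℓ                             ≡⟨ cong (ℓ *_) (*-identityʳ ℓ) ⟨
        ℓ ^ 2                             ∎

      covered : ∀ {R} → R ∈ L → 1 ≤ degree R pairs
      covered R∈L =
        let A , A∈R , A∈P = intersect R∈L (here refl)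
            ∣A∣≡k , _     = All.lookup (proj₁ (proj₂ (All.lookup subp (here refl)))) A∈P
            Q∈L           = firstWithout∈ A L (λ all → noCommon (A , ∣A∣≡k , all))
            C , C∈R , C∈Q = intersect R∈L Q∈L
            AC∈pairs      = ∈-concatMap⁺ partner (Any.map (λ { refl → ∈-map⁺ (A ,_) C∈Q }) A∈P)
        in Unique⇒length≤degree ([] ∷ []) ((AC∈pairs , A∈R , C∈R) ∷ [])

IsSubpartition-classes : ∀ {n k ℓ} (P : Subpartition n k ℓ) → IsSubpartition k ℓ ⊤ (classes P)
IsSubpartition-classes P = size P , All.map (λ ∣A∣≡k → ∣A∣≡k , λ {_} → ⊆⊤) (allK P) , disjoint P

-- The hypothesis n ≥ kℓ only guarantees that (k, ℓ)-subpartitions exist.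
lemma1 : (n k ℓ : ℕ) → 1 ≤ k → 2 ≤ ℓ → n ≥ k * ℓ →
    (𝒫 : Family n k ℓ) → IsIntersecting 𝒫 → ¬ HasCommonClass 𝒫 →
    card 𝒫 ≤ ℓ ^ 2 * U (n ∸ 2 * k) (ℓ ∸ 2) k
lemma1 n k (suc (suc j)) 1≤k (s≤s (s≤s _)) _ 𝒫 intersecting noCommon =
  subst₂ (λ l m → l ≤ (2 + j) ^ 2 * U (m ∸ 2 * k) j k) (length-map classes ms) (∣⊤∣≡n n)
    (intersecting-bound 1≤k j ⊤ (map classes ms)
      (AllPairs.map⁺ (distinct 𝒫))
      (All.map⁺ (All.universal IsSubpartition-classes ms))
      intersect
      (λ (A , ∣A∣≡k , all) → noCommon (A , ∣A∣≡k , All.map⁻ all)))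
  where
  ms = members 𝒫

  intersect : ∀ {R R′} → R ∈ map classes ms → R′ ∈ map classes ms → Σ (Subset n) λ A → A ∈ R × A ∈ R′
  intersect R∈ R′∈ with ∈-map⁻ classes R∈ | ∈-map⁻ classes R′∈
  ... | P , P∈ , refl | Q , Q∈ , refl = intersecting P Q P∈ Q∈
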